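{- Let $I$ be an instance and $v$ a variety. A solid of variety $v$ is composable from $I$ if and only if $|T|\le |I(T)|$ for every subset $T\subseteq T_v$, where $I(T)$ denotes the sub-multiset of cubes of $I$ whose variety has at least one corner triple in $T$.
   Context: Fix a palette of six distinct colors, totally ordered. A (colored) cube is a unit cube each of whose six faces is painted with exactly one color of the palette, all six faces receiving different colors. Two colored cubes have the same variety if one can be rotated onto the other (30 varieties). An instance is a finite multiset of colored cubes; sizes of multisets are counted with multiplicity. A solid is a $2\times2\times2$ cube assembled from eight colored unit cubes such that each of its six outer $2\times2$ faces is of a single color and the six outer faces have six different colors; its variety is defined as for unit cubes. A solid of variety $v$ is composable from $I$ if some eight cubes of $I$ can be placed and oriented to form a solid of variety $v$. For a corner of a cube, its corner triple is the ordered triple of the three colors of the faces meeting at that corner, listed in clockwise order around the corner and cyclically rotated so that the smallest color comes first; $T_v$ denotes the set of eight corner triples of variety $v$. -}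

module Defs where

open import Data.Bool using (Bool; true; false; not; _xor_)
open import Data.Fin using (Fin; _<?_)
import Data.Fin as Fin
open import Data.Nat using (ℕ; _≤_)
open import Data.Product using (Σ; ∃; _×_; _,_; proj₁)
open import Data.Product.Properties using (≡-dec)
open import Data.List using (List; []; _∷_; length; filter; lookup; map)
open import Data.List.Membership.Propositional using (_∈_)
open import Data.List.Relation.Unary.Any using (Any; any?)
open import Data.List.Relation.Unary.All using (All)
open import Data.List.Relation.Unary.Unique.Propositional using (Unique)
open import Relation.Nullary using (Dec; yes; no)
open import Relation.Binary.PropositionalEquality using (_≡_)
open import Relation.Binary.Definitions using (DecidableEquality)
open import Function.Definitions using (Injective)

Colour : Set
Colour = Fin 6

data Axis : Set where
  X Y Z : Axis

-- A face is an axis together with a side: true = positive side, false = negative.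
Face : Set
Face = Axis × Bool

-- Rotations of the cube: the rotation group is generated by the quarter
-- turns about the x-axis and about the z-axis; a rotation is a word in them.
data Rotation : Set where
  idR : Rotation
  rx  : Rotation → Rotation
  rz  : Rotation → Rotation

qx : Face → Face
qx (X , s) = X , s
qx (Y , s) = Z , s
qx (Z , s) = Y , not s

qz : Face → Face
qz (Z , s) = Z , s
qz (X , s) = Y , s
qz (Y , s) = X , not s

act : Rotation → Face → Face
act idR   f = f
act (rx r) f = act r (qx f)
act (rz r) f = act r (qz f)

Colouring : Set
Colouring = Face → Colour

Cube : Set
Cube = Σ Colouring (Injective _≡_ _≡_)

colour : Cube → Colouring
colour = proj₁

rotate : Rotation → Colouring → Colouring
rotate r col f = col (act r f)

SameVariety : Colouring → Colouring → Set
SameVariety c d = ∃ λ (r : Rotation) → ∀ (f : Face) → rotate r c f ≡ d f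

Triple : Set
Triple = Colour × Colour × Colour

_≟T_ : DecidableEquality Triple
_≟T_ = ≡-dec Fin._≟_ (≡-dec Fin._≟_ Fin._≟_)

open import Data.List.Membership.DecPropositional _≟T_ using (_∈?_)

-- cyclic rotation of a triple so that the smallest colour comes first
-- (the three colours of a cube corner are pairwise distinct)
canon : Colour → Colour → Colour → Triple
canon a b c with a <? b | a <? c | b <? c
... | yes _ | yes _ | _     = a , b , c
... | _     | _     | yes _ = b , c , a
... | _     | _     | no _  = c , a , b

Corner : Set
Corner = Bool × Bool × Bool

-- Clockwise order of the faces around a corner, viewed from outside.
-- In a right-handed frame, at corner (+,+,+) the order x → y → z is
-- counter-clockwise seen from outside, so clockwise is x, z, y; each
-- minus sign reverses orientation.
cornerTriple : Colouring → Corner → Triple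
cornerTriple col (sx , sy , sz) with sx xor sy xor sz
... | true  = canon (col (X , sx)) (col (Z , sz)) (col (Y , sy))  -- even number of minus signs
... | false = canon (col (X , sx)) (col (Y , sy)) (col (Z , sz))  -- odd number of minus signs

allCorners : List Corner
allCorners =
  (false , false , false) ∷ (false , false , true) ∷ (false , true , false) ∷ (false , true , true) ∷
  (true , false , false) ∷ (true , false , true) ∷ (true , true , false) ∷ (true , true , true) ∷ []

cornerTriples : Colouring → List Triple
cornerTriples col = map (cornerTriple col) allCorners

-- T_v : the eight corner triples of the variety of v (rotation invariant).
T : Colouring → List Triple
T = cornerTriples

-- Instances: finite multisets of cubes, represented as lists
-- (multiplicity = number of occurrences; order irrelevant for everything below).

Instance : Set
Instance = List Cube

hits? : (S : List Triple) → (q : Cube) → Dec (Any (_∈ S) (cornerTriples (colour q)))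
hits? S q = any? (_∈? S) (cornerTriples (colour q))

countHits : List Triple → Instance → ℕ
countHits S I = length (filter (hits? S) I)

-- 2×2×2 solids.  The unit cube at position p = (px , py , pz) (each coordinate
-- true = positive half) has face (a , s) on the outside iff its a-coordinate is s.

Position : Set
Position = Bool × Bool × Bool

coord : Position → Axis → Bool
coord (px , py , pz) X = px
coord (px , py , pz) Y = py
coord (px , py , pz) Z = pz

-- An assembly assigns to each position an (absolutely oriented) colouring.
IsSolidWith : (Position → Colouring) → Colouring → Set
IsSolidWith asm S =
  Injective _≡_ _≡_ S ×
  (∀ (p : Position) (a : Axis) (s : Bool) → coord p a ≡ s → asm p (a , s) ≡ S (a , s))

Composable : Instance → Cube → Set
Composable I v =
  ∃ λ (pick : Position → Fin (length I)) → Injective _≡_ _≡_ pick ×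
  ∃ λ (rot : Position → Rotation) →
  ∃ λ (S : Colouring) →
    IsSolidWith (λ p → rotate (rot p) (colour (lookup I (pick p)))) S ×
    SameVariety S (colour v)

module Submission where

-- A solid is assembled by putting at each position p of the 2×2×2 cube a unit cube whose
-- corner p carries the three outer colours there, i.e. (up to rotating the whole solid) the
-- corner triple of v at p.  Corner triples are invariant under rotation and the rotations act
-- transitively on oriented corners, so a cube can be turned into position p exactly when
-- T_v(p) is one of its corner triples.  Hence a solid of variety v is the same thing as an
-- injective assignment of cubes of I to the eight corners of v respecting "T_v(c) is a corner
-- triple of the cube": a perfect matching in a bipartite graph.  The eight triples of v are
-- distinct, so the stated inequalities are precisely Hall's condition for this graph, and
-- Hall's theorem, by the Halmos–Vaughan induction on tight sets, finishes the proof.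

open import Defs
open import Data.Bool using (true; false; _xor_)
import Data.Bool.Properties as Bool
open import Data.Empty using (⊥-elim)
open import Data.Fin using (Fin; zero; suc)
import Data.Fin as Fin
import Data.Fin.Properties as Fin
open import Data.Fin.Subset
  using (Subset; inside; outside; _∩_; _∪_; _─_; _-_; ⁅_⁆; ∣_∣; _⊆_; Nonempty; Empty)
  renaming (_∈_ to _∈ₛ_; _∉_ to _∉ₛ_; ⊤ to ⊤ₛ)
open import Data.Fin.Subset.Properties
  using ( nonempty?; anySubset?; _⊆?_; ∈⊤; ∣p∣≤n; ∩-identityʳ; ⊆-trans; p⊆q⇒∣p∣≤∣q∣
        ; Empty-unique; ∣⊥∣≡0; x∈⁅x⁆; x∈⁅y⁆⇒x≡y; ∣⁅x⁆∣≡1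
        ; x∈p∩q⁺; x∈p∩q⁻; p∩q⊆p; p∩q⊆q; x∈p∪q⁻; p⊆p∪q; q⊆p∪q
        ; x∈p∧x∉q⇒x∈p─q; p─q⊆p; x∈p⇒∣p-x∣<∣p∣; p∩q≢∅⇒∣p─q∣<∣p∣ )
  renaming (_∈?_ to _∈ₛ?_)
open import Data.List using (List; []; _∷_; length; map; filter; lookup; _++_)
open import Data.List.Membership.Propositional using (_∈_; find; lose)
open import Data.List.Membership.DecPropositional _≟T_ using (_∈?_)
open import Data.List.Membership.Propositional.Properties using (∈-map⁺; ∈-map⁻; ∈-lookup)
open import Data.List.Properties using (length-map)
open import Data.List.Relation.Unary.All as All using (All)
open import Data.List.Relation.Unary.AllPairs using ([]; _∷_)
open import Data.List.Relation.Unary.Any as Any using (Any; here; there; satisfied)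
open import Data.List.Relation.Unary.Unique.Propositional using (Unique)
import Data.List.Relation.Unary.Unique.Propositional.Properties as Unique
open import Data.Nat using (ℕ; zero; suc; _≤_; _<_; _+_; z≤n; _≤?_)
open import Data.Nat.Properties
  using ( ≤-trans; ≤-<-trans; <-≤-trans; ≤-pred; ≰⇒>; n≮0; +-suc; +-mono-≤; +-monoˡ-≤; +-cancelˡ-≤
        ; module ≤-Reasoning )
open import Data.Product using (∃; ∃₂; _×_; _,_; proj₁; proj₂)
open import Data.Product.Properties using (≡-dec)
open import Data.Sum using (_⊎_; inj₁; inj₂)
open import Data.Unit using (tt)
open import Data.Vec using (tabulate; here; there; []; _∷_)
open import Function using (_∘_)
open import Function.Bundles using (_⇔_; mk⇔)
open import Function.Definitions using (Injective)
open import Level using (0ℓ)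
open import Relation.Binary.Definitions using (DecidableEquality)
open import Relation.Binary.PropositionalEquality
  using (_≡_; _≢_; refl; sym; trans; cong; cong₂; subst; module ≡-Reasoning)
open import Relation.Nullary using (Dec; yes; no; does; ¬?; contradiction)
open import Relation.Nullary.Decidable using (toWitness; _×-dec_; _→-dec_)
open import Relation.Unary using (Pred; Decidable)

-- Finite subsets and Hall's theorem

select : ∀ {n} {P : Pred (Fin n) 0ℓ} → Decidable P → Subset n
select P? = tabulate (does ∘ P?)

∈-select⁺ : ∀ {n} {P : Pred (Fin n) 0ℓ} (P? : Decidable P) {i} → P i → i ∈ₛ select P?
∈-select⁺ P? {zero} Pi with P? zero
... | yes _  = here
... | no ¬Pi = contradiction Pi ¬Pi
∈-select⁺ P? {suc i} Pi = there (∈-select⁺ (P? ∘ suc) Pi)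

∈-select⁻ : ∀ {n} {P : Pred (Fin n) 0ℓ} (P? : Decidable P) {i} → i ∈ₛ select P? → P i
∈-select⁻ P? {zero} i∈ with P? zero | i∈
... | yes Pi | _ = Pi
... | no _   | ()
∈-select⁻ P? {suc i} (there i∈) = ∈-select⁻ (P? ∘ suc) i∈

∣select∘lookup∣ : ∀ {A : Set} {P : Pred A 0ℓ} (P? : Decidable P) (xs : List A) →
  ∣ select (P? ∘ lookup xs) ∣ ≡ length (filter P? xs)
∣select∘lookup∣ P? []       = refl
∣select∘lookup∣ P? (x ∷ xs) with does (P? x)
... | true  = cong suc (∣select∘lookup∣ P? xs)
... | false = ∣select∘lookup∣ P? xs

∣p∣≡∣p∩q∣+∣p─q∣ : ∀ {n} (p q : Subset n) → ∣ p ∣ ≡ ∣ p ∩ q ∣ + ∣ p ─ q ∣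
∣p∣≡∣p∩q∣+∣p─q∣ []            []            = refl
∣p∣≡∣p∩q∣+∣p─q∣ (inside  ∷ p) (inside  ∷ q) = cong suc (∣p∣≡∣p∩q∣+∣p─q∣ p q)
∣p∣≡∣p∩q∣+∣p─q∣ (inside  ∷ p) (outside ∷ q) = trans (cong suc (∣p∣≡∣p∩q∣+∣p─q∣ p q)) (sym (+-suc _ _))
∣p∣≡∣p∩q∣+∣p─q∣ (outside ∷ p) (inside  ∷ q) = ∣p∣≡∣p∩q∣+∣p─q∣ p q
∣p∣≡∣p∩q∣+∣p─q∣ (outside ∷ p) (outside ∷ q) = ∣p∣≡∣p∩q∣+∣p─q∣ p q

module _ {n : ℕ} {p q r s : Subset n} where

  ∣r∣≤∣p∣+∣q∣ : r ∩ s ⊆ p → r ─ s ⊆ q → ∣ r ∣ ≤ ∣ p ∣ + ∣ q ∣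
  ∣r∣≤∣p∣+∣q∣ r∩s⊆p r─s⊆q = subst (_≤ ∣ p ∣ + ∣ q ∣) (sym (∣p∣≡∣p∩q∣+∣p─q∣ r s))
    (+-mono-≤ (p⊆q⇒∣p∣≤∣q∣ r∩s⊆p) (p⊆q⇒∣p∣≤∣q∣ r─s⊆q))

  ∣p∣+∣q∣≤∣r∣ : p ⊆ r ∩ s → q ⊆ r ─ s → ∣ p ∣ + ∣ q ∣ ≤ ∣ r ∣
  ∣p∣+∣q∣≤∣r∣ p⊆r∩s q⊆r─s = subst (∣ p ∣ + ∣ q ∣ ≤_) (sym (∣p∣≡∣p∩q∣+∣p─q∣ r s))
    (+-mono-≤ (p⊆q⇒∣p∣≤∣q∣ p⊆r∩s) (p⊆q⇒∣p∣≤∣q∣ q⊆r─s))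

x∈p─q⇒x∉q : ∀ {n} (p q : Subset n) {x} → x ∈ₛ p ─ q → x ∉ₛ q
x∈p─q⇒x∉q (inside ∷ p)  (outside ∷ q) here       ()
x∈p─q⇒x∉q (_      ∷ p)  (_       ∷ q) (there x∈) (there x∈q) = x∈p─q⇒x∉q p q x∈ x∈q

Empty⇒∣p∣≡0 : ∀ {n} {p : Subset n} → Empty p → ∣ p ∣ ≡ 0
Empty⇒∣p∣≡0 {n} empty = trans (cong ∣_∣ (Empty-unique empty)) (∣⊥∣≡0 n)

0<∣p∣⇒Nonempty : ∀ {n} {p : Subset n} → 0 < ∣ p ∣ → Nonempty p
0<∣p∣⇒Nonempty {p = p} 0<∣p∣ with nonempty? p
... | yes ne    = ne
... | no  empty = contradiction (subst (0 <_) (Empty⇒∣p∣≡0 empty) 0<∣p∣) λ ()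

rank : ∀ {n} {p : Subset n} {i} → i ∈ₛ p → Fin ∣ p ∣
rank {p = inside  ∷ p} here       = zero
rank {p = inside  ∷ p} (there i∈) = suc (rank i∈)
rank {p = outside ∷ p} (there i∈) = rank i∈

rank-injective : ∀ {n} {p : Subset n} {i j} (i∈ : i ∈ₛ p) (j∈ : j ∈ₛ p) → rank i∈ ≡ rank j∈ → i ≡ j
rank-injective {p = inside  ∷ p} here        here        _ = refl
rank-injective {p = inside  ∷ p} (there i∈) (there j∈) e = cong suc (rank-injective i∈ j∈ (Fin.suc-injective e))
rank-injective {p = outside ∷ p} (there i∈) (there j∈) e = cong suc (rank-injective i∈ j∈ e)

injective⇒≤∣p∣ : ∀ {k n} {p : Subset n} {f : Fin k → Fin n} →
  Injective _≡_ _≡_ f → (∀ i → f i ∈ₛ p) → k ≤ ∣ p ∣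
injective⇒≤∣p∣ f-inj f∈p = Fin.injective⇒≤ (f-inj ∘ rank-injective (f∈p _) (f∈p _))

elements : ∀ {n} → Subset n → List (Fin n)
elements []            = []
elements (inside  ∷ p) = zero ∷ map suc (elements p)
elements (outside ∷ p) = map suc (elements p)

length-elements : ∀ {n} (p : Subset n) → length (elements p) ≡ ∣ p ∣
length-elements []            = refl
length-elements (inside  ∷ p) = cong suc (trans (length-map suc (elements p)) (length-elements p))
length-elements (outside ∷ p) = trans (length-map suc (elements p)) (length-elements p)

∈-elements⁻ : ∀ {n} (p : Subset n) {i} → i ∈ elements p → i ∈ₛ p
∈-elements⁻ (inside ∷ p) (here refl) = here
∈-elements⁻ (inside ∷ p) (there i∈) with ∈-map⁻ suc i∈
... | j , j∈ , refl = there (∈-elements⁻ p j∈)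
∈-elements⁻ (outside ∷ p) i∈ with ∈-map⁻ suc i∈
... | j , j∈ , refl = there (∈-elements⁻ p j∈)

elements-unique : ∀ {n} (p : Subset n) → Unique (elements p)
elements-unique []            = []
elements-unique (inside  ∷ p) =
  All.tabulate (λ j∈ 0≡j → Fin.0≢1+n (trans 0≡j (proj₂ (proj₂ (∈-map⁻ suc j∈)))))
  ∷ Unique.map⁺ Fin.suc-injective (elements-unique p)
elements-unique (outside ∷ p) = Unique.map⁺ Fin.suc-injective (elements-unique p)

module _ {n m : ℕ} (N : Fin n → Subset m) where

  adjacentTo? : (S : Subset n) (j : Fin m) → Dec (∃ λ i → i ∈ₛ S × j ∈ₛ N i)
  adjacentTo? S j = Fin.any? λ i → (i ∈ₛ? S) ×-dec (j ∈ₛ? N i)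

  nbhd : Subset n → Subset m
  nbhd S = select (adjacentTo? S)

  ∈-nbhd⁺ : ∀ {S i j} → i ∈ₛ S → j ∈ₛ N i → j ∈ₛ nbhd S
  ∈-nbhd⁺ {S} i∈S j∈Ni = ∈-select⁺ (adjacentTo? S) (_ , i∈S , j∈Ni)

  ∈-nbhd⁻ : ∀ {S j} → j ∈ₛ nbhd S → ∃ λ i → i ∈ₛ S × j ∈ₛ N i
  ∈-nbhd⁻ {S} = ∈-select⁻ (adjacentTo? S)

  nbhd-mono : ∀ {S S'} → S ⊆ S' → nbhd S ⊆ nbhd S'
  nbhd-mono S⊆S' j∈ with ∈-nbhd⁻ j∈
  ... | i , i∈S , j∈Ni = ∈-nbhd⁺ (S⊆S' i∈S) j∈Ni

  ∈-nbhd-∪⁻ : ∀ S S' {j} → j ∈ₛ nbhd (S ∪ S') → j ∈ₛ nbhd S ⊎ j ∈ₛ nbhd S'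
  ∈-nbhd-∪⁻ S S' j∈ with ∈-nbhd⁻ j∈
  ... | i , i∈S∪S' , j∈Ni with x∈p∪q⁻ S S' i∈S∪S'
  ...   | inj₁ i∈S  = inj₁ (∈-nbhd⁺ i∈S j∈Ni)
  ...   | inj₂ i∈S' = inj₂ (∈-nbhd⁺ i∈S' j∈Ni)

  ∈-nbhd-⁅⁆⁻ : ∀ {a j} → j ∈ₛ nbhd ⁅ a ⁆ → j ∈ₛ N a
  ∈-nbhd-⁅⁆⁻ {a} j∈ with ∈-nbhd⁻ j∈
  ... | i , i∈⁅a⁆ , j∈Ni = subst (λ i → _ ∈ₛ N i) (x∈⁅y⁆⇒x≡y a i∈⁅a⁆) j∈Ni

  HallCondition : Subset n → Subset m → Set
  HallCondition L R = ∀ S → S ⊆ L → ∣ S ∣ ≤ ∣ nbhd S ∩ R ∣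

  record Matching (L : Subset n) (R : Subset m) : Set where
    field
      partner           : ∀ {i} → i ∈ₛ L → Fin m
      partner-adjacent  : ∀ {i} (i∈L : i ∈ₛ L) → partner i∈L ∈ₛ N i
      partner-∈         : ∀ {i} (i∈L : i ∈ₛ L) → partner i∈L ∈ₛ R
      partner-injective : ∀ {i j} (i∈L : i ∈ₛ L) (j∈L : j ∈ₛ L) → partner i∈L ≡ partner j∈L → i ≡ j

  matching-empty : ∀ {L R} → Empty L → Matching L R
  matching-empty empty = record
    { partner           = λ i∈L → ⊥-elim (empty (_ , i∈L))
    ; partner-adjacent  = λ i∈L → ⊥-elim (empty (_ , i∈L))
    ; partner-∈         = λ i∈L → ⊥-elim (empty (_ , i∈L))
    ; partner-injective = λ i∈L _ _ → ⊥-elim (empty (_ , i∈L))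
    }

  matching-⁅⁆ : ∀ {a y R} → y ∈ₛ N a → y ∈ₛ R → Matching ⁅ a ⁆ (R ∩ ⁅ y ⁆)
  matching-⁅⁆ {a} {y} y∈Na y∈R = record
    { partner           = λ _ → y
    ; partner-adjacent  = λ i∈⁅a⁆ → subst (λ i → y ∈ₛ N i) (sym (x∈⁅y⁆⇒x≡y a i∈⁅a⁆)) y∈Na
    ; partner-∈         = λ _ → x∈p∩q⁺ (y∈R , x∈⁅x⁆ y)
    ; partner-injective = λ i∈⁅a⁆ j∈⁅a⁆ _ → trans (x∈⁅y⁆⇒x≡y a i∈⁅a⁆) (sym (x∈⁅y⁆⇒x≡y a j∈⁅a⁆))
    }

  matching-join : ∀ {L R} S Q → Matching S (R ∩ Q) → Matching (L ─ S) (R ─ Q) → Matching L R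
  matching-join {L} {R} S Q M₁ M₂ = record
    { partner = partner ; partner-adjacent = adjacent ; partner-∈ = in-R ; partner-injective = injective }
    where
    module M₁ = Matching M₁
    module M₂ = Matching M₂

    partner : ∀ {i} → i ∈ₛ L → Fin m
    partner {i} i∈L with i ∈ₛ? S
    ... | yes i∈S = M₁.partner i∈S
    ... | no  i∉S = M₂.partner (x∈p∧x∉q⇒x∈p─q i∈L i∉S)

    adjacent : ∀ {i} (i∈L : i ∈ₛ L) → partner i∈L ∈ₛ N i
    adjacent {i} i∈L with i ∈ₛ? S
    ... | yes i∈S = M₁.partner-adjacent i∈S
    ... | no  i∉S = M₂.partner-adjacent _

    in-R : ∀ {i} (i∈L : i ∈ₛ L) → partner i∈L ∈ₛ R
    in-R {i} i∈L with i ∈ₛ? S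
    ... | yes i∈S = p∩q⊆p R Q (M₁.partner-∈ i∈S)
    ... | no  i∉S = p─q⊆p R Q (M₂.partner-∈ _)

    apart : ∀ {i j} (i∈S : i ∈ₛ S) (j∈L─S : j ∈ₛ L ─ S) → M₁.partner i∈S ≡ M₂.partner j∈L─S → i ≡ j
    apart i∈S j∈L─S e = ⊥-elim (x∈p─q⇒x∉q R Q (M₂.partner-∈ j∈L─S)
      (subst (_∈ₛ Q) e (p∩q⊆q R Q (M₁.partner-∈ i∈S))))

    injective : ∀ {i j} (i∈L : i ∈ₛ L) (j∈L : j ∈ₛ L) → partner i∈L ≡ partner j∈L → i ≡ j
    injective {i} {j} i∈L j∈L e with i ∈ₛ? S | j ∈ₛ? S
    ... | yes i∈S | yes j∈S = M₁.partner-injective i∈S j∈S e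
    ... | yes i∈S | no  _   = apart i∈S _ e
    ... | no  _   | yes j∈S = sym (apart j∈S _ (sym e))
    ... | no  _   | no  _   = M₂.partner-injective _ _ e

  hall-⊆ : ∀ {L R S} → HallCondition L R → S ⊆ L → HallCondition S (R ∩ nbhd S)
  hall-⊆ {R = R} {S} hallLR S⊆L S' S'⊆S = ≤-trans (hallLR S' (⊆-trans S'⊆S S⊆L)) (p⊆q⇒∣p∣≤∣q∣ shrink)
    where
    shrink : nbhd S' ∩ R ⊆ nbhd S' ∩ (R ∩ nbhd S)
    shrink j∈ with x∈p∩q⁻ (nbhd S') R j∈
    ... | j∈NS' , j∈R = x∈p∩q⁺ (j∈NS' , x∈p∩q⁺ (j∈R , nbhd-mono S'⊆S j∈NS'))

  -- A tight S (|N(S) ∩ R| ≤ |S|) uses up its whole neighbourhood, so the rest of L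
  -- still satisfies Hall's condition once N(S) is removed from R.
  hall-─ : ∀ {L R S} → HallCondition L R → S ⊆ L → ∣ nbhd S ∩ R ∣ ≤ ∣ S ∣ →
    HallCondition (L ─ S) (R ─ nbhd S)
  hall-─ {L} {R} {S} hallLR S⊆L tight S' S'⊆L─S = +-cancelˡ-≤ ∣ S ∣ _ _ (begin
    ∣ S ∣ + ∣ S' ∣                       ≤⟨ ∣p∣+∣q∣≤∣r∣ {r = U} {s = S} S⊆U∩S S'⊆U─S ⟩
    ∣ U ∣                                ≤⟨ hallLR U U⊆L ⟩
    ∣ nbhd U ∩ R ∣                       ≤⟨ ∣r∣≤∣p∣+∣q∣ {s = nbhd S} NU∩NS⊆ NU─NS⊆ ⟩
    ∣ nbhd S ∩ R ∣ + ∣ nbhd S' ∩ (R ─ nbhd S) ∣ ≤⟨ +-monoˡ-≤ _ tight ⟩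
    ∣ S ∣ + ∣ nbhd S' ∩ (R ─ nbhd S) ∣   ∎)
    where
    open ≤-Reasoning
    U : Subset n
    U = S' ∪ S

    S⊆U∩S : S ⊆ U ∩ S
    S⊆U∩S i∈S = x∈p∩q⁺ (q⊆p∪q S' S i∈S , i∈S)

    S'⊆U─S : S' ⊆ U ─ S
    S'⊆U─S i∈S' = x∈p∧x∉q⇒x∈p─q (p⊆p∪q S i∈S') (x∈p─q⇒x∉q L S (S'⊆L─S i∈S'))

    U⊆L : U ⊆ L
    U⊆L i∈U with x∈p∪q⁻ S' S i∈U
    ... | inj₁ i∈S' = p─q⊆p L S (S'⊆L─S i∈S')
    ... | inj₂ i∈S  = S⊆L i∈S

    NU∩NS⊆ : (nbhd U ∩ R) ∩ nbhd S ⊆ nbhd S ∩ R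
    NU∩NS⊆ j∈ with x∈p∩q⁻ (nbhd U ∩ R) (nbhd S) j∈
    ... | j∈NU∩R , j∈NS = x∈p∩q⁺ (j∈NS , p∩q⊆q (nbhd U) R j∈NU∩R)

    NU─NS⊆ : (nbhd U ∩ R) ─ nbhd S ⊆ nbhd S' ∩ (R ─ nbhd S)
    NU─NS⊆ j∈ with x∈p∩q⁻ (nbhd U) R (p─q⊆p (nbhd U ∩ R) (nbhd S) j∈)
    ... | j∈NU , j∈R with ∈-nbhd-∪⁻ S' S j∈NU
    ...   | inj₁ j∈NS' = x∈p∩q⁺ (j∈NS' , x∈p∧x∉q⇒x∈p─q j∈R j∉NS)
      where j∉NS = x∈p─q⇒x∉q (nbhd U ∩ R) (nbhd S) j∈
    ...   | inj₂ j∈NS  = ⊥-elim (x∈p─q⇒x∉q (nbhd U ∩ R) (nbhd S) j∈ j∈NS)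

  -- Removing y from R shrinks each N(S) ∩ R by at most one, which the surplus absorbs.
  hall-delete : ∀ {L R a y} → (∀ S → S ⊆ L - a → Nonempty S → ∣ S ∣ < ∣ nbhd S ∩ R ∣) →
    HallCondition (L - a) (R - y)
  hall-delete {R = R} {y = y} surplus S S⊆L-a with nonempty? S
  ... | no empty = subst (_≤ ∣ nbhd S ∩ (R - y) ∣) (sym (Empty⇒∣p∣≡0 empty)) z≤n
  ... | yes ne = ≤-pred (begin
    suc ∣ S ∣                           ≤⟨ surplus S S⊆L-a ne ⟩
    ∣ nbhd S ∩ R ∣                      ≤⟨ ∣r∣≤∣p∣+∣q∣ {s = ⁅ y ⁆} (p∩q⊆q (nbhd S ∩ R) ⁅ y ⁆) NS─y⊆ ⟩
    ∣ ⁅ y ⁆ ∣ + ∣ nbhd S ∩ (R - y) ∣    ≡⟨ cong (_+ ∣ nbhd S ∩ (R - y) ∣) (∣⁅x⁆∣≡1 y) ⟩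
    suc ∣ nbhd S ∩ (R - y) ∣            ∎)
    where
    open ≤-Reasoning
    NS─y⊆ : (nbhd S ∩ R) ─ ⁅ y ⁆ ⊆ nbhd S ∩ (R - y)
    NS─y⊆ j∈ with x∈p∩q⁻ (nbhd S) R (p─q⊆p (nbhd S ∩ R) ⁅ y ⁆ j∈)
    ... | j∈NS , j∈R = x∈p∩q⁺ (j∈NS , x∈p∧x∉q⇒x∈p─q j∈R (x∈p─q⇒x∉q (nbhd S ∩ R) ⁅ y ⁆ j∈))

  Tight : Subset n → Subset m → Fin n → Subset n → Set
  Tight L R a S = S ⊆ L - a × Nonempty S × ∣ nbhd S ∩ R ∣ ≤ ∣ S ∣

  tight? : ∀ L R a S → Dec (Tight L R a S)
  tight? L R a S = (S ⊆? L - a) ×-dec nonempty? S ×-dec (∣ nbhd S ∩ R ∣ ≤? ∣ S ∣)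

  -- Induction on |L|: either some nonempty S ⊆ L - a is tight, and L splits along it,
  -- or every such S has a surplus, and a can be matched to any neighbour y.
  hall-within : ∀ k {L R} → ∣ L ∣ ≤ k → HallCondition L R → Matching L R
  hall-within zero ∣L∣≤0 _ =
    matching-empty λ (a , a∈L) → n≮0 (<-≤-trans (x∈p⇒∣p-x∣<∣p∣ a∈L) ∣L∣≤0)
  hall-within (suc k) {L} {R} ∣L∣≤1+k hallLR with nonempty? L
  ... | no empty = matching-empty empty
  ... | yes (a , a∈L) with anySubset? (tight? L R a)
  ...   | yes (S , S⊆L-a , (b , b∈S) , tight) =
    matching-join S (nbhd S)
      (hall-within k (smaller S (≤-<-trans (p⊆q⇒∣p∣≤∣q∣ S⊆L-a) (x∈p⇒∣p-x∣<∣p∣ a∈L))) (hall-⊆ hallLR S⊆L))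
      (hall-within k (smaller (L ─ S) (p∩q≢∅⇒∣p─q∣<∣p∣ L S (b , x∈p∩q⁺ (S⊆L b∈S , b∈S)))) (hall-─ hallLR S⊆L tight))
    where
    smaller : ∀ L' → ∣ L' ∣ < ∣ L ∣ → ∣ L' ∣ ≤ k
    smaller _ lt = ≤-pred (<-≤-trans lt ∣L∣≤1+k)
    S⊆L : S ⊆ L
    S⊆L = ⊆-trans S⊆L-a (p─q⊆p L ⁅ a ⁆)
  ...   | no ¬tight =
    matching-join ⁅ a ⁆ ⁅ y ⁆ (matching-⁅⁆ (∈-nbhd-⁅⁆⁻ y∈N⁅a⁆) y∈R)
      (hall-within k (≤-pred (<-≤-trans (x∈p⇒∣p-x∣<∣p∣ a∈L) ∣L∣≤1+k)) (hall-delete surplus))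
    where
    ⁅a⁆⊆L : ⁅ a ⁆ ⊆ L
    ⁅a⁆⊆L i∈⁅a⁆ = subst (_∈ₛ L) (sym (x∈⁅y⁆⇒x≡y a i∈⁅a⁆)) a∈L
    neighbour : Nonempty (nbhd ⁅ a ⁆ ∩ R)
    neighbour = 0<∣p∣⇒Nonempty (subst (_≤ ∣ nbhd ⁅ a ⁆ ∩ R ∣) (∣⁅x⁆∣≡1 a) (hallLR ⁅ a ⁆ ⁅a⁆⊆L))
    y : Fin m
    y = proj₁ neighbour
    y∈N⁅a⁆ : y ∈ₛ nbhd ⁅ a ⁆
    y∈N⁅a⁆ = p∩q⊆p (nbhd ⁅ a ⁆) R (proj₂ neighbour)
    y∈R : y ∈ₛ R
    y∈R = p∩q⊆q (nbhd ⁅ a ⁆) R (proj₂ neighbour)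
    surplus : ∀ S → S ⊆ L - a → Nonempty S → ∣ S ∣ < ∣ nbhd S ∩ R ∣
    surplus S S⊆L-a ne = ≰⇒> λ tight → ¬tight (S , S⊆L-a , ne , tight)

  hall : (∀ S → ∣ S ∣ ≤ ∣ nbhd S ∣) →
    ∃ λ (f : Fin n → Fin m) → Injective _≡_ _≡_ f × ∀ i → f i ∈ₛ N i
  hall hallN = (λ i → partner (∈⊤ {x = i})) , partner-injective ∈⊤ ∈⊤ , λ _ → partner-adjacent ∈⊤
    where
    open Matching (hall-within n {⊤ₛ} {⊤ₛ} (∣p∣≤n ⊤ₛ) λ S _ →
      subst (λ X → ∣ S ∣ ≤ ∣ X ∣) (sym (∩-identityʳ (nbhd S))) (hallN S))

Unique⇒lookup-injective : {A : Set} {xs : List A} → Unique xs → Injective _≡_ _≡_ (lookup xs)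
Unique⇒lookup-injective (_  ∷ _)      {zero}  {zero}  _ = refl
Unique⇒lookup-injective (x∉ ∷ _)      {zero}  {suc j} e = ⊥-elim (All.lookup x∉ (∈-lookup j) e)
Unique⇒lookup-injective (x∉ ∷ _)      {suc i} {zero}  e = ⊥-elim (All.lookup x∉ (∈-lookup i) (sym e))
Unique⇒lookup-injective (_  ∷ xs-uniq) {suc i} {suc j} e = cong suc (Unique⇒lookup-injective xs-uniq e)

-- Cyclic triples

Tri : Set → Set
Tri A = A × A × A

map₃ : {A B : Set} → (A → B) → Tri A → Tri B
map₃ f (x , y , z) = f x , f y , f z

map₃-injective : {A B : Set} {f : A → B} → Injective _≡_ _≡_ f → Injective _≡_ _≡_ (map₃ f)
map₃-injective f-inj e =
  cong₂ _,_ (f-inj (cong proj₁ e)) (cong₂ _,_ (f-inj (cong (proj₁ ∘ proj₂) e)) (f-inj (cong (proj₂ ∘ proj₂) e)))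

Distinct₃ : {A : Set} → Tri A → Set
Distinct₃ (x , y , z) = x ≢ y × x ≢ z × y ≢ z

distinct₃? : {A : Set} → DecidableEquality A → (t : Tri A) → Dec (Distinct₃ t)
distinct₃? _≟_ (x , y , z) = ¬? (x ≟ y) ×-dec ¬? (x ≟ z) ×-dec ¬? (y ≟ z)

Distinct₃-map : {A B : Set} {f : A → B} → Injective _≡_ _≡_ f → ∀ t → Distinct₃ t → Distinct₃ (map₃ f t)
Distinct₃-map f-inj _ (x≢y , x≢z , y≢z) = x≢y ∘ f-inj , x≢z ∘ f-inj , y≢z ∘ f-inj

data Shift : Set where
  ↻₀ ↻₁ ↻₂ : Shift

allShifts : List Shift
allShifts = ↻₀ ∷ ↻₁ ∷ ↻₂ ∷ []

∈-allShifts : ∀ k → k ∈ allShifts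
∈-allShifts ↻₀ = here refl
∈-allShifts ↻₁ = there (here refl)
∈-allShifts ↻₂ = there (there (here refl))

shift : {A : Set} → Shift → Tri A → Tri A
shift ↻₀ t           = t
shift ↻₁ (x , y , z) = y , z , x
shift ↻₂ (x , y , z) = z , x , y

infixl 6 _⊕_
infix 7 ⊖_

_⊕_ : Shift → Shift → Shift
↻₀ ⊕ l  = l
↻₁ ⊕ ↻₀ = ↻₁
↻₁ ⊕ ↻₁ = ↻₂
↻₁ ⊕ ↻₂ = ↻₀
↻₂ ⊕ ↻₀ = ↻₂
↻₂ ⊕ ↻₁ = ↻₀
↻₂ ⊕ ↻₂ = ↻₁

⊖_ : Shift → Shift
⊖ ↻₀ = ↻₀
⊖ ↻₁ = ↻₂
⊖ ↻₂ = ↻₁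

module _ {A : Set} where

  shift-⊕ : ∀ k l (t : Tri A) → shift k (shift l t) ≡ shift (k ⊕ l) t
  shift-⊕ ↻₀ l  t = refl
  shift-⊕ ↻₁ ↻₀ t = refl
  shift-⊕ ↻₁ ↻₁ t = refl
  shift-⊕ ↻₁ ↻₂ t = refl
  shift-⊕ ↻₂ ↻₀ t = refl
  shift-⊕ ↻₂ ↻₁ t = refl
  shift-⊕ ↻₂ ↻₂ t = refl

  shift-⊖ : ∀ k (t : Tri A) → shift (⊖ k) (shift k t) ≡ t
  shift-⊖ ↻₀ t = refl
  shift-⊖ ↻₁ t = refl
  shift-⊖ ↻₂ t = refl

  shift-map₃ : {B : Set} (k : Shift) (f : A → B) (t : Tri A) → shift k (map₃ f t) ≡ map₃ f (shift k t)
  shift-map₃ ↻₀ f t = refl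
  shift-map₃ ↻₁ f t = refl
  shift-map₃ ↻₂ f t = refl

canon₃ : Triple → Triple
canon₃ (a , b , c) = canon a b c

canon₃-is-shift : ∀ t → ∃ λ k → canon₃ t ≡ shift k t
canon₃-is-shift (a , b , c) with a Fin.<? b | a Fin.<? c | b Fin.<? c
... | yes _ | yes _ | _     = ↻₀ , refl
... | yes _ | no _  | yes _ = ↻₁ , refl
... | yes _ | no _  | no _  = ↻₂ , refl
... | no _  | _     | yes _ = ↻₁ , refl
... | no _  | _     | no _  = ↻₂ , refl

canon₃-shift⁻ : ∀ s t → canon₃ s ≡ canon₃ t → ∃ λ k → t ≡ shift k s
canon₃-shift⁻ s t e with canon₃-is-shift s | canon₃-is-shift t
... | i , s≈ | j , t≈ = ⊖ j ⊕ i , (begin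
  t                         ≡⟨ sym (shift-⊖ j t) ⟩
  shift (⊖ j) (shift j t)   ≡⟨ cong (shift (⊖ j)) (trans (sym t≈) (trans (sym e) s≈)) ⟩
  shift (⊖ j) (shift i s)   ≡⟨ shift-⊕ (⊖ j) i s ⟩
  shift (⊖ j ⊕ i) s         ∎)
  where open ≡-Reasoning

abstract
  canon-cyclic : ∀ a b c → a ≢ b → a ≢ c → b ≢ c → canon b c a ≡ canon a b c
  canon-cyclic = toWitness {a? = Fin.all? λ a → Fin.all? λ b → Fin.all? λ c →
    ¬? (a Fin.≟ b) →-dec ¬? (a Fin.≟ c) →-dec ¬? (b Fin.≟ c) →-dec (canon b c a ≟T canon a b c)} tt

canon₃-shift : ∀ k t → Distinct₃ t → canon₃ (shift k t) ≡ canon₃ t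
canon₃-shift ↻₀ t _ = refl
canon₃-shift ↻₁ (a , b , c) (a≢b , a≢c , b≢c) = canon-cyclic a b c a≢b a≢c b≢c
canon₃-shift ↻₂ (a , b , c) (a≢b , a≢c , b≢c) =
  trans (canon-cyclic b c a b≢c (a≢b ∘ sym) (a≢c ∘ sym)) (canon-cyclic a b c a≢b a≢c b≢c)

-- Corners and rotations of the cube

_≟ₐ_ : DecidableEquality Axis
X ≟ₐ X = yes refl
X ≟ₐ Y = no λ ()
X ≟ₐ Z = no λ ()
Y ≟ₐ X = no λ ()
Y ≟ₐ Y = yes refl
Y ≟ₐ Z = no λ ()
Z ≟ₐ X = no λ ()
Z ≟ₐ Y = no λ ()
Z ≟ₐ Z = yes refl

_≟ᶠ_ : DecidableEquality Face
_≟ᶠ_ = ≡-dec _≟ₐ_ Bool._≟_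

_≟ᶠ₃_ : DecidableEquality (Tri Face)
_≟ᶠ₃_ = ≡-dec _≟ᶠ_ (≡-dec _≟ᶠ_ _≟ᶠ_)

_≟ᶜ_ : DecidableEquality Corner
_≟ᶜ_ = ≡-dec Bool._≟_ (≡-dec Bool._≟_ Bool._≟_)

∈-allCorners : ∀ c → c ∈ allCorners
∈-allCorners (false , false , false) = here refl
∈-allCorners (false , false , true)  = there (here refl)
∈-allCorners (false , true  , false) = there (there (here refl))
∈-allCorners (false , true  , true)  = there (there (there (here refl)))
∈-allCorners (true  , false , false) = there (there (there (there (here refl))))
∈-allCorners (true  , false , true)  = there (there (there (there (there (here refl)))))
∈-allCorners (true  , true  , false) = there (there (there (there (there (there (here refl))))))
∈-allCorners (true  , true  , true)  = there (there (there (there (there (there (there (here refl)))))))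

cornerAt : Fin 8 → Corner
cornerAt = lookup allCorners

cornerIndex : Corner → Fin 8
cornerIndex (false , false , false) = zero
cornerIndex (false , false , true)  = suc zero
cornerIndex (false , true  , false) = suc (suc zero)
cornerIndex (false , true  , true)  = suc (suc (suc zero))
cornerIndex (true  , false , false) = suc (suc (suc (suc zero)))
cornerIndex (true  , false , true)  = suc (suc (suc (suc (suc zero))))
cornerIndex (true  , true  , false) = suc (suc (suc (suc (suc (suc zero)))))
cornerIndex (true  , true  , true)  = suc (suc (suc (suc (suc (suc (suc zero))))))

cornerAt-cornerIndex : ∀ c → cornerAt (cornerIndex c) ≡ c
cornerAt-cornerIndex (false , false , false) = refl
cornerAt-cornerIndex (false , false , true)  = refl
cornerAt-cornerIndex (false , true  , false) = refl
cornerAt-cornerIndex (false , true  , true)  = refl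
cornerAt-cornerIndex (true  , false , false) = refl
cornerAt-cornerIndex (true  , false , true)  = refl
cornerAt-cornerIndex (true  , true  , false) = refl
cornerAt-cornerIndex (true  , true  , true)  = refl

cornerIndex-cornerAt : ∀ i → cornerIndex (cornerAt i) ≡ i
cornerIndex-cornerAt zero = refl
cornerIndex-cornerAt (suc zero) = refl
cornerIndex-cornerAt (suc (suc zero)) = refl
cornerIndex-cornerAt (suc (suc (suc zero))) = refl
cornerIndex-cornerAt (suc (suc (suc (suc zero)))) = refl
cornerIndex-cornerAt (suc (suc (suc (suc (suc zero))))) = refl
cornerIndex-cornerAt (suc (suc (suc (suc (suc (suc zero)))))) = refl
cornerIndex-cornerAt (suc (suc (suc (suc (suc (suc (suc zero))))))) = refl

cornerIndex-injective : Injective _≡_ _≡_ cornerIndex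
cornerIndex-injective {c} {d} e =
  trans (sym (cornerAt-cornerIndex c)) (trans (cong cornerAt e) (cornerAt-cornerIndex d))

cornerAt-injective : Injective _≡_ _≡_ cornerAt
cornerAt-injective {i} {j} e =
  trans (sym (cornerIndex-cornerAt i)) (trans (cong cornerIndex e) (cornerIndex-cornerAt j))

cornerFaces : Corner → Tri Face
cornerFaces (sx , sy , sz) with sx xor sy xor sz
... | true  = (X , sx) , (Z , sz) , (Y , sy)
... | false = (X , sx) , (Y , sy) , (Z , sz)

cornerTriple-canon : (col : Colouring) (p : Corner) → cornerTriple col p ≡ canon₃ (map₃ col (cornerFaces p))
cornerTriple-canon col (sx , sy , sz) with sx xor sy xor sz
... | true  = refl
... | false = refl

cornerColours-≡⁺ : (col col' : Colouring) (p : Corner) → (∀ a → col (a , coord p a) ≡ col' (a , coord p a)) →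
  map₃ col (cornerFaces p) ≡ map₃ col' (cornerFaces p)
cornerColours-≡⁺ col col' (sx , sy , sz) e with sx xor sy xor sz
... | true  = cong₂ _,_ (e X) (cong₂ _,_ (e Z) (e Y))
... | false = cong₂ _,_ (e X) (cong₂ _,_ (e Y) (e Z))

cornerColours-≡⁻ : (col col' : Colouring) (p : Corner) → map₃ col (cornerFaces p) ≡ map₃ col' (cornerFaces p) →
  ∀ a → col (a , coord p a) ≡ col' (a , coord p a)
cornerColours-≡⁻ col col' (sx , sy , sz) e with sx xor sy xor sz
... | true  = λ { X → cong proj₁ e ; Y → cong (proj₂ ∘ proj₂) e ; Z → cong (proj₁ ∘ proj₂) e }
... | false = λ { X → cong proj₁ e ; Y → cong (proj₁ ∘ proj₂) e ; Z → cong (proj₂ ∘ proj₂) e }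

cornerTriple-local : (col col' : Colouring) (p : Corner) → (∀ a → col (a , coord p a) ≡ col' (a , coord p a)) →
  cornerTriple col p ≡ cornerTriple col' p
cornerTriple-local col col' p e = begin
  cornerTriple col p                   ≡⟨ cornerTriple-canon col p ⟩
  canon₃ (map₃ col (cornerFaces p))    ≡⟨ cong canon₃ (cornerColours-≡⁺ col col' p e) ⟩
  canon₃ (map₃ col' (cornerFaces p))   ≡⟨ sym (cornerTriple-canon col' p) ⟩
  cornerTriple col' p                  ∎
  where open ≡-Reasoning

everyCorner : {P : Corner → Set} → All P allCorners → ∀ c → P c
everyCorner h c = All.lookup h (∈-allCorners c)

everyShift : {P : Shift → Set} → All P allShifts → ∀ k → P k
everyShift h k = All.lookup h (∈-allShifts k)

-- g preserves orientation: clockwise face triples go to clockwise face triples.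
Oriented : (Face → Face) → Set
Oriented g = ∀ p → ∃₂ λ c k → map₃ g (cornerFaces p) ≡ shift k (cornerFaces c)

orientedAt? : (g : Face → Face) (p : Corner) → Dec (Any (λ c → Any (λ k →
  map₃ g (cornerFaces p) ≡ shift k (cornerFaces c)) allShifts) allCorners)
orientedAt? g p = Any.any? (λ c → Any.any? (λ k →
  map₃ g (cornerFaces p) ≟ᶠ₃ shift k (cornerFaces c)) allShifts) allCorners

oriented-by-search : (g : Face → Face) → All (λ p → Any (λ c → Any (λ k →
  map₃ g (cornerFaces p) ≡ shift k (cornerFaces c)) allShifts) allCorners) allCorners → Oriented g
oriented-by-search g h p with satisfied (everyCorner h p)
... | c , k∈ = c , satisfied k∈

abstract
  qx-oriented : Oriented qx
  qx-oriented = oriented-by-search qx (toWitness {a? = All.all? (orientedAt? qx) allCorners} tt)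

  qz-oriented : Oriented qz
  qz-oriented = oriented-by-search qz (toWitness {a? = All.all? (orientedAt? qz) allCorners} tt)

  cornerFaces-distinct : ∀ c → Distinct₃ (cornerFaces c)
  cornerFaces-distinct = everyCorner (toWitness {a? = All.all? (distinct₃? _≟ᶠ_ ∘ cornerFaces) allCorners} tt)

  cornerFaces-rigid : ∀ c d k → cornerFaces d ≡ shift k (cornerFaces c) → c ≡ d
  cornerFaces-rigid c d = everyShift (everyCorner (everyCorner (toWitness {a? =
    All.all? (λ c → All.all? (λ d → All.all? (λ k →
      (cornerFaces d ≟ᶠ₃ shift k (cornerFaces c)) →-dec (c ≟ᶜ d)) allShifts) allCorners) allCorners} tt) c) d)

-- Words of length at most 5 in the two quarter turns already realise every rotation.
rotations : ℕ → List Rotation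
rotations zero    = idR ∷ []
rotations (suc n) = idR ∷ map rx (rotations n) ++ map rz (rotations n)

abstract
  rotation-onto : ∀ c p k → ∃ λ r → map₃ (act r) (cornerFaces p) ≡ shift k (cornerFaces c)
  rotation-onto c p k = satisfied (everyShift (everyCorner (everyCorner (toWitness {a? =
    All.all? (λ c → All.all? (λ p → All.all? (λ k → Any.any? (λ r →
      map₃ (act r) (cornerFaces p) ≟ᶠ₃ shift k (cornerFaces c)) (rotations 5)) allShifts) allCorners) allCorners} tt) c) p) k)

Oriented-∘ : {g h : Face → Face} → Oriented g → Oriented h → Oriented (h ∘ g)
Oriented-∘ {g} {h} g-or h-or p with g-or p
... | c , k , gp≡ with h-or c
... | d , l , hc≡ = d , k ⊕ l , (begin
  map₃ h (map₃ g (cornerFaces p))     ≡⟨ cong (map₃ h) gp≡ ⟩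
  map₃ h (shift k (cornerFaces c))    ≡⟨ sym (shift-map₃ k h (cornerFaces c)) ⟩
  shift k (map₃ h (cornerFaces c))    ≡⟨ cong (shift k) hc≡ ⟩
  shift k (shift l (cornerFaces d))   ≡⟨ shift-⊕ k l (cornerFaces d) ⟩
  shift (k ⊕ l) (cornerFaces d)       ∎)
  where open ≡-Reasoning

act-oriented : ∀ r → Oriented (act r)
act-oriented idR    p = p , ↻₀ , refl
act-oriented (rx r) = Oriented-∘ {qx} {act r} qx-oriented (act-oriented r)
act-oriented (rz r) = Oriented-∘ {qz} {act r} qz-oriented (act-oriented r)

cornerTriple-rotate : (col : Colouring) → Injective _≡_ _≡_ col →
  ∀ r p → cornerTriple (rotate r col) p ∈ cornerTriples col
cornerTriple-rotate col col-inj r p with act-oriented r p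
... | c , k , rp≡ = subst (_∈ cornerTriples col) (sym same) (∈-map⁺ (cornerTriple col) (∈-allCorners c))
  where
  open ≡-Reasoning
  same : cornerTriple (rotate r col) p ≡ cornerTriple col c
  same = begin
    cornerTriple (rotate r col) p                     ≡⟨ cornerTriple-canon (rotate r col) p ⟩
    canon₃ (map₃ col (map₃ (act r) (cornerFaces p)))  ≡⟨ cong (canon₃ ∘ map₃ col) rp≡ ⟩
    canon₃ (map₃ col (shift k (cornerFaces c)))       ≡⟨ cong canon₃ (sym (shift-map₃ k col (cornerFaces c))) ⟩
    canon₃ (shift k (map₃ col (cornerFaces c)))       ≡⟨ canon₃-shift k _ (Distinct₃-map col-inj _ (cornerFaces-distinct c)) ⟩
    canon₃ (map₃ col (cornerFaces c))                 ≡⟨ sym (cornerTriple-canon col c) ⟩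
    cornerTriple col c                                ∎

cornerTriple-shift⁻ : (col col' : Colouring) (c p : Corner) → cornerTriple col c ≡ cornerTriple col' p →
  ∃ λ k → map₃ col' (cornerFaces p) ≡ map₃ col (shift k (cornerFaces c))
cornerTriple-shift⁻ col col' c p e
  with canon₃-shift⁻ _ _ (trans (sym (cornerTriple-canon col c)) (trans e (cornerTriple-canon col' p)))
... | k , col'p≡ = k , trans col'p≡ (shift-map₃ k col (cornerFaces c))

cornerTriple-injective : (col : Colouring) → Injective _≡_ _≡_ col → Injective _≡_ _≡_ (cornerTriple col)
cornerTriple-injective col col-inj {c} {d} e with cornerTriple-shift⁻ col col c d e
... | k , coldp≡ = cornerFaces-rigid c d k (map₃-injective col-inj coldp≡)

align : (col col' : Colouring) (c p : Corner) → cornerTriple col c ≡ cornerTriple col' p →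
  ∃ λ r → ∀ a → rotate r col (a , coord p a) ≡ col' (a , coord p a)
align col col' c p e with cornerTriple-shift⁻ col col' c p e
... | k , col'p≡ with rotation-onto c p k
... | r , rp≡ = r , cornerColours-≡⁻ (rotate r col) col' p (trans (cong (map₃ col) rp≡) (sym col'p≡))

-- Solids as matchings of corners

CornerMatching : Instance → Cube → Set
CornerMatching I v = ∃ λ (pick : Corner → Fin (length I)) → Injective _≡_ _≡_ pick ×
  ∀ c → cornerTriple (colour v) c ∈ cornerTriples (colour (lookup I (pick c)))

-- Corner c of v goes to the cube at the position where the solid shows T_v(c).
composable⇒cornerMatching : ∀ I v → Composable I v → CornerMatching I v
composable⇒cornerMatching I v (pick , pick-inj , rot , S , (S-inj , outer) , r₀ , S≈v) =
  pick ∘ place , place-injective ∘ pick-inj , served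
  where
  tv : Corner → Triple
  tv = cornerTriple (colour v)

  shownOnSolid : ∀ c → ∃ λ p → tv c ≡ cornerTriple S p
  shownOnSolid c with ∈-map⁻ (cornerTriple S) {xs = allCorners} (subst (_∈ cornerTriples S)
    (cornerTriple-local (rotate r₀ S) (colour v) c (λ a → S≈v _)) (cornerTriple-rotate S S-inj r₀ c))
  ... | p , _ , e = p , e

  place : Corner → Position
  place c = proj₁ (shownOnSolid c)

  place-injective : Injective _≡_ _≡_ place
  place-injective {c} {d} e = cornerTriple-injective (colour v) (proj₂ v)
    (trans (proj₂ (shownOnSolid c)) (trans (cong (cornerTriple S) e) (sym (proj₂ (shownOnSolid d)))))

  served : ∀ c → tv c ∈ cornerTriples (colour (lookup I (pick (place c))))
  served c = subst (_∈ cornerTriples cube) (sym (trans (proj₂ (shownOnSolid c)) onCube))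
    (cornerTriple-rotate cube (proj₂ (lookup I (pick p))) (rot p) p)
    where
    p : Position
    p = place c
    cube : Colouring
    cube = colour (lookup I (pick p))
    onCube : cornerTriple S p ≡ cornerTriple (rotate (rot p) cube) p
    onCube = cornerTriple-local S _ p (λ a → sym (outer p a (coord p a) refl))

cornerMatching⇒composable : ∀ I v → CornerMatching I v → Composable I v
cornerMatching⇒composable I v (pick , pick-inj , served) =
  pick , pick-inj , rot , colour v , (proj₂ v , outer) , idR , λ _ → refl
  where
  aligned : ∀ p → ∃ λ r → ∀ a →
    rotate r (colour (lookup I (pick p))) (a , coord p a) ≡ colour v (a , coord p a)
  aligned p with ∈-map⁻ (cornerTriple (colour (lookup I (pick p)))) {xs = allCorners} (served p)
  ... | c , _ , e = align (colour (lookup I (pick p))) (colour v) c p (sym e)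

  rot : Position → Rotation
  rot p = proj₁ (aligned p)

  outer : ∀ p a s → coord p a ≡ s → rotate (rot p) (colour (lookup I (pick p))) (a , s) ≡ colour v (a , s)
  outer p a _ refl = proj₂ (aligned p) a

-- The inequalities of the theorem as Hall's condition

module _ (I : Instance) (v : Cube) where

  TripleHallCondition : Set
  TripleHallCondition =
    ∀ (S : List Triple) → Unique S → All (_∈ T (colour v)) S → length S ≤ countHits S I

  tripleAt : Fin 8 → Triple
  tripleAt i = cornerTriple (colour v) (cornerAt i)

  tripleAt-injective : Injective _≡_ _≡_ tripleAt
  tripleAt-injective = cornerAt-injective ∘ cornerTriple-injective (colour v) (proj₂ v)

  servedBy? : (i : Fin 8) (j : Fin (length I)) → Dec (tripleAt i ∈ cornerTriples (colour (lookup I j)))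
  servedBy? i j = tripleAt i ∈? cornerTriples (colour (lookup I j))

  adjacency : Fin 8 → Subset (length I)
  adjacency i = select (servedBy? i)

  hitting : List Triple → Subset (length I)
  hitting S = select (hits? S ∘ lookup I)

  cornerMatching⇒tripleHall : CornerMatching I v → TripleHallCondition
  cornerMatching⇒tripleHall (pick , pick-injective , served) S S-unique S⊆Tv =
    subst (length S ≤_) (∣select∘lookup∣ (hits? S) I) (injective⇒≤∣p∣ g-injective g-hits)
    where
    shownAt : ∀ k → ∃ λ c → c ∈ allCorners × lookup S k ≡ cornerTriple (colour v) c
    shownAt k = ∈-map⁻ (cornerTriple (colour v)) (All.lookup S⊆Tv (∈-lookup k))

    g : Fin (length S) → Fin (length I)
    g k = pick (proj₁ (shownAt k))

    g-injective : Injective _≡_ _≡_ g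
    g-injective {k} {l} e = Unique⇒lookup-injective S-unique
      (trans (proj₂ (proj₂ (shownAt k))) (trans (cong (cornerTriple (colour v)) (pick-injective e))
        (sym (proj₂ (proj₂ (shownAt l))))))

    g-hits : ∀ k → g k ∈ₛ hitting S
    g-hits k = ∈-select⁺ (hits? S ∘ lookup I)
      (lose (served (proj₁ (shownAt k))) (subst (_∈ S) (proj₂ (proj₂ (shownAt k))) (∈-lookup k)))

  tripleHall⇒hall : TripleHallCondition → ∀ S → ∣ S ∣ ≤ ∣ nbhd adjacency S ∣
  tripleHall⇒hall hallT S = begin
    ∣ S ∣                     ≡⟨ sym (length-elements S) ⟩
    length (elements S)       ≡⟨ sym (length-map tripleAt (elements S)) ⟩
    length triples            ≤⟨ hallT triples triples-unique triples⊆Tv ⟩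
    countHits triples I       ≡⟨ sym (∣select∘lookup∣ (hits? triples) I) ⟩
    ∣ hitting triples ∣       ≤⟨ p⊆q⇒∣p∣≤∣q∣ hitting⊆nbhd ⟩
    ∣ nbhd adjacency S ∣      ∎
    where
    open ≤-Reasoning
    triples : List Triple
    triples = map tripleAt (elements S)

    triples-unique : Unique triples
    triples-unique = Unique.map⁺ tripleAt-injective (elements-unique S)

    triples⊆Tv : All (_∈ T (colour v)) triples
    triples⊆Tv = All.tabulate λ t∈ → inTv (∈-map⁻ tripleAt t∈)
      where
      inTv : ∀ {t} → ∃ (λ i → i ∈ elements S × t ≡ tripleAt i) → t ∈ T (colour v)
      inTv (i , _ , refl) = ∈-map⁺ (cornerTriple (colour v)) (∈-allCorners (cornerAt i))

    -- Destructured by helper functions: a with here normalises nbhd adjacency S, which is very slow.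
    hitting⊆nbhd : hitting triples ⊆ nbhd adjacency S
    hitting⊆nbhd {j} j∈ = servedTriple (find (∈-select⁻ (hits? triples ∘ lookup I) j∈))
      where
      servedTriple : ∃ (λ t → t ∈ cornerTriples (colour (lookup I j)) × t ∈ triples) → j ∈ₛ nbhd adjacency S
      servedTriple (t , t∈cube , t∈triples) = servedCorner (∈-map⁻ tripleAt t∈triples)
        where
        servedCorner : ∃ (λ i → i ∈ elements S × t ≡ tripleAt i) → j ∈ₛ nbhd adjacency S
        servedCorner (i , i∈S , refl) = ∈-nbhd⁺ adjacency (∈-elements⁻ S i∈S) (∈-select⁺ (servedBy? i) t∈cube)

  tripleHall⇒cornerMatching : TripleHallCondition → CornerMatching I v
  tripleHall⇒cornerMatching hallT = viaCornerIndex (hall adjacency (tripleHall⇒hall hallT))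
    where
    viaCornerIndex : (∃ λ (f : Fin 8 → Fin (length I)) → Injective _≡_ _≡_ f × ∀ i → f i ∈ₛ adjacency i) →
      CornerMatching I v
    viaCornerIndex (f , f-injective , f-adjacent) = f ∘ cornerIndex , cornerIndex-injective ∘ f-injective , served
      where
      served : ∀ c → cornerTriple (colour v) c ∈ cornerTriples (colour (lookup I (f (cornerIndex c))))
      served c = subst (λ c' → cornerTriple (colour v) c' ∈ cornerTriples (colour (lookup I (f (cornerIndex c)))))
        (cornerAt-cornerIndex c) (∈-select⁻ (servedBy? (cornerIndex c)) (f-adjacent (cornerIndex c)))

corollary1 : (I : Instance) (v : Cube) →
    Composable I v ⇔
      (∀ (S : List Triple) → Unique S → All (_∈ T (colour v)) S →
        length S ≤ countHits S I)
corollary1 I v = mk⇔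
  (cornerMatching⇒tripleHall I v ∘ composable⇒cornerMatching I v)
  (cornerMatching⇒composable I v ∘ tripleHall⇒cornerMatching I v)
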